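{- Let $G=(I\cup C,E)$ and the word $w$ be as in the context. If $a,b\in I$ are distinct, then $a$ and $b$ do not alternate in $w$.
   Context: For a word $w$ and letters $a,b$, $w|_{\{a,b\}}$ is the subsequence of $w$ of all occurrences of $a,b$; $a,b$ alternate in $w$ if $w|_{\{a,b\}}$ is $abab\cdots$ or $baba\cdots$ (any length). Let $G=(I\cup C,E)$ be a split graph, $I$ independent, $C$ a clique, with $C$ inclusion-wise maximal (no vertex of $I$ is adjacent to all of $C$). For integers $x\le y$ write $[x,y]=\{x,\dots,y\}$. Assume the vertices of $C$ are labelled $1,\dots,k$ ($k=|C|$) so that for all $a,b\in I$: (i) either $N(a)=[1,m]\cup[n,k]$ for some $m<n$, or $N(a)=[l,r]$ for some $l\le r$; (ii) if $N(a)=[1,m]\cup[n,k]$ ($m<n$) and $N(b)=[l,r]$ ($l\le r$) then $l>m$ or $r<n$; (iii) if $N(a)=[1,m]\cup[n,k]$ and $N(b)=[1,m']\cup[n',k]$ ($m<n$, $m'<n'$) then $m'<n$ and $m<n'$. Let $A$ be the set of $a\in I$ whose neighbourhood is of the form $[1,m]\cup[n,k]$ with $1\le m$, $m+1<n\le k$ (not an interval), and $B$ the set of $a\in I$ with $N(a)$ an interval $[l,r]$; $I=A\cup B$ disjointly. Construction: initialise $p_1=p_2=p_3=12\cdots k$ and $d=1$. For each $a\in I$ in turn: if $a\in A$ with $N(a)=[1,m]\cup[n,k]$, set $d:=m$ if $m>d$, insert $a$ immediately after the letter $m$ in $p_1$ and immediately before the letter $n$ in $p_2$; if $a\in B$ with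 $N(a)=[l,r]$, insert $a$ immediately before $l$ in $p_1$ and immediately after $r$ in $p_2$. Then replace the letter $d$ in $p_3$ by $d\,(p_1|_A)^R$ ($p_1|_A$ the subsequence of $p_1$ of letters in $A$, $^R$ reversal). Set $w=p_1\,(p_1|_B)^R\,p_2\,p_3$, a 3-uniform word over $I\cup C$. -}

module Defs where

open import Data.Nat using (ℕ; zero; suc; _≤_; _<_; _⊔_; _≡ᵇ_)
open import Data.Fin using (Fin)
open import Data.Fin.Properties using () renaming (_≟_ to _≟F_)
open import Data.List.Base using (List; []; _∷_; _++_; map; filterᵇ; reverse; concatMap; applyUpTo; length; foldl)
open import Data.List using (allFin)
open import Data.Bool.Base using (Bool; true; false; if_then_else_; _∨_)
open import Data.Product using (_×_; _,_)
open import Data.Sum using (_⊎_)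
open import Data.Unit using (⊤)
open import Relation.Nullary using (¬_; does)
open import Relation.Binary.PropositionalEquality using (_≡_)

-- Split graph G = (I ∪ C, E) with C = {1,…,k} a clique and I = Fin n
-- independent.  The graph is determined by N(a) ⊆ C for a ∈ I; each
-- N(a) is recorded by its shape (the context asserts I = A ∪ B):
--   nbA m n' :  N(a) = [1,m] ∪ [n',k]   (a ∈ A)
--   nbB l r  :  N(a) = [l,r]            (a ∈ B)

data Nb : Set where
  nbA : ℕ → ℕ → Nb
  nbB : ℕ → ℕ → Nb

Nbhd : ℕ → Nb → ℕ → Set
Nbhd k (nbA m n') c = (1 ≤ c × c ≤ m) ⊎ (n' ≤ c × c ≤ k)
Nbhd k (nbB l r)  c = l ≤ c × c ≤ r

-- Shape constraints defining A and B, plus maximality of the clique C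
-- (no vertex of I is adjacent to all of C = [1,k]).
ValidNb : ℕ → Nb → Set
ValidNb k (nbA m n') = 1 ≤ m × suc m < n' × n' ≤ k
ValidNb k (nbB l r)  = (1 ≤ l × l ≤ r × r ≤ k) × ¬ (l ≡ 1 × r ≡ k)

Compat : Nb → Nb → Set
Compat (nbA m n') (nbB l r)   = m < l ⊎ r < n'
Compat (nbA m n') (nbA m′ n″) = m′ < n' × m < n″
Compat (nbB _ _)  _           = ⊤

isA : Nb → Bool
isA (nbA _ _) = true
isA (nbB _ _) = false

data Letter (n : ℕ) : Set where
  cv : ℕ → Letter n        -- clique vertex (label in 1..k)
  iv : Fin n → Letter n

_==_ : {n : ℕ} → Letter n → Letter n → Bool
cv x == cv y = x ≡ᵇ y
iv a == iv b = does (a ≟F b)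
_    == _    = false

Word : ℕ → Set
Word n = List (Letter n)

insertAfter : {n : ℕ} → Letter n → Letter n → Word n → Word n
insertAfter x y []       = []
insertAfter x y (z ∷ zs) = if z == x then z ∷ y ∷ zs else z ∷ insertAfter x y zs

insertBefore : {n : ℕ} → Letter n → Letter n → Word n → Word n
insertBefore x y []       = []
insertBefore x y (z ∷ zs) = if z == x then y ∷ z ∷ zs else z ∷ insertBefore x y zs

initWord : {n : ℕ} → ℕ → Word n
initWord k = applyUpTo (λ i → cv (suc i)) k

record State (n : ℕ) : Set where
  constructor st
  field
    p₁ : Word n
    p₂ : Word n
    d  : ℕ

step : {n : ℕ} → (Fin n → Nb) → State n → Fin n → State n
step N (st p₁ p₂ d) a with N a
... | nbA m n' = st (insertAfter (cv m) (iv a) p₁) (insertBefore (cv n') (iv a) p₂) (d ⊔ m)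
... | nbB l r  = st (insertBefore (cv l) (iv a) p₁) (insertAfter (cv r) (iv a) p₂) d

final : {n : ℕ} → ℕ → (Fin n → Nb) → State n
final {n} k N = foldl (step N) (st (initWord k) (initWord k) 1) (allFin n)

inA : {n : ℕ} → (Fin n → Nb) → Letter n → Bool
inA N (cv _) = false
inA N (iv a) = isA (N a)

inB : {n : ℕ} → (Fin n → Nb) → Letter n → Bool
inB N (cv _) = false
inB N (iv a) = if isA (N a) then false else true

wordW : {n : ℕ} → ℕ → (Fin n → Nb) → Word n
wordW k N = p₁ ++ reverse (filterᵇ (inB N) p₁) ++ p₂ ++ p₃
  where
  open State (final k N)
  revA = reverse (filterᵇ (inA N) p₁)
  p₃ = concatMap (λ z → if z == cv d then z ∷ revA else z ∷ []) (initWord k)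

restrict : {n : ℕ} → Letter n → Letter n → Word n → Word n
restrict x y = filterᵇ (λ z → (z == x) ∨ (z == y))

altWord : {n : ℕ} → Letter n → Letter n → ℕ → Word n
altWord x y zero    = []
altWord x y (suc ℓ) = x ∷ altWord y x ℓ

Alternate : {n : ℕ} → Letter n → Letter n → Word n → Set
Alternate x y w =
  let u = restrict x y w in
  (u ≡ altWord x y (length u)) ⊎ (u ≡ altWord y x (length u))

-- Restricted to two vertices a, b of I, the word w reads
--   r₁ (r₁|B)^R r₂ (r₁|A)^R,   where rᵢ = pᵢ|{a,b},
-- because p₃ contains the block (p₁|A)^R exactly once (1 ≤ d ≤ k).  Each of
-- a, b occurs exactly once in p₁ and in p₂, so r₁, r₂ ∈ {ab, ba}, and checking
-- the few cases shows that the word alternates only when, say, a ∈ B precedes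
-- b ∈ A in p₁ while b precedes a in p₂.  The construction keeps p₁ and p₂
-- sorted by explicit position keys relative to the clique labels, so for
-- N(a) = [l,r] and N(b) = [1,m] ∪ [n,k] this means l ≤ m and n ≤ r,
-- contradicting condition (ii).

module Submission where

open import Defs
open import Data.Bool.Base using (Bool; true; false; _∨_; if_then_else_)
open import Data.Bool.Properties using (T-≡)
open import Data.Empty using (⊥; ⊥-elim)
open import Data.Fin using (Fin)
open import Data.Fin.Properties using () renaming (_≟_ to _≟F_)
open import Data.List.Base
  using (List; []; _∷_; _++_; [_]; filter; filterᵇ; reverse; reverseAcc; length; concat; concatMap; replicate; map; foldl; allFin)
open import Data.List.Properties using (filter-++; length-++; unfold-reverse; ++-identityʳ)
open import Data.List.Membership.Propositional using (_∈_; _∉_)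
open import Data.List.Membership.Propositional.Properties using (∈-++⁺ʳ; ∈-map⁺; ∈-allFin; ∈-applyUpTo⁺; ∈-applyUpTo⁻)
open import Data.List.Relation.Unary.All using (All; []; _∷_)
import Data.List.Relation.Unary.All as All
open import Data.List.Relation.Unary.All.Properties using (All¬⇒¬Any; applyUpTo⁺₂)
open import Data.List.Relation.Unary.Any using (here; there)
open import Data.List.Relation.Unary.AllPairs using (AllPairs; []; _∷_)
import Data.List.Relation.Unary.AllPairs.Properties as AllPairs
open import Data.List.Relation.Unary.Unique.Propositional using (Unique)
open import Data.List.Relation.Unary.Unique.Propositional.Properties using (allFin⁺)
import Data.List.Relation.Unary.Unique.Propositional.Properties as Unique
open import Data.List.Relation.Binary.Permutation.Propositional using (_↭_; ↭-refl; ↭-prep; ↭-swap; ↭-trans; ↭-sym)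
open import Data.List.Relation.Binary.Permutation.Propositional.Properties
  using (filter-↭; ↭-length; All-resp-↭; Any-resp-↭; ++⁺ʳ; ↭-reverse)
import Data.List.Relation.Binary.Permutation.Propositional.Properties as ↭
open import Data.Nat using (ℕ; zero; suc; _+_; _≤_; _<_; z≤n; s≤s; s≤s⁻¹)
open import Data.Nat.Properties
  using (≡ᵇ⇒≡; ≡⇒≡ᵇ; suc-injective; ≤-refl; ≤-trans; <-trans; ≤-<-trans; <⇒≤; <⇒≱; <-irrefl; n≤1+n; n<1+n; m≤m⊔n; ⊔-lub)
open import Data.Product using (_×_; _,_)
open import Data.Sum using (_⊎_; inj₁; inj₂; [_,_]′)
import Data.Sum as Sum
open import Function using (_∘_)
open import Function.Bundles using (Equivalence)
open import Relation.Nullary using (¬_; does; yes; no)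
open import Relation.Nullary.Decidable using (T?)
open import Relation.Unary using (Pred; Decidable)
open import Relation.Binary.PropositionalEquality
  using (_≡_; _≢_; refl; sym; trans; cong; cong₂; subst; module ≡-Reasoning)

private
  variable
    n : ℕ

iv-injective : {a b : Fin n} → iv {n} a ≡ iv b → a ≡ b
iv-injective refl = refl

==⇒≡ : (x y : Letter n) → (x == y) ≡ true → x ≡ y
==⇒≡ (cv c) (cv c′) eq = cong cv (≡ᵇ⇒≡ c c′ (Equivalence.from T-≡ eq))
==⇒≡ (iv a) (iv b) eq with a ≟F b
... | yes a≡b = cong iv a≡b
==⇒≡ (iv a) (iv b) () | no _

==-refl : (x : Letter n) → (x == x) ≡ true
==-refl (cv c) = Equivalence.to T-≡ (≡⇒≡ᵇ c c refl)
==-refl (iv a) with a ≟F a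
... | yes _ = refl
... | no a≢a = ⊥-elim (a≢a refl)

module _ {a p} {A : Set a} {P : Pred A p} (P? : Decidable P) where

  filter-reverse : (xs : List A) → filter P? (reverse xs) ≡ reverse (filter P? xs)
  filter-reverse [] = refl
  filter-reverse (x ∷ xs) = begin
    filter P? (reverse (x ∷ xs))              ≡⟨ cong (filter P?) (unfold-reverse x xs) ⟩
    filter P? (reverse xs ++ [ x ])           ≡⟨ filter-++ P? (reverse xs) [ x ] ⟩
    filter P? (reverse xs) ++ filter P? [ x ] ≡⟨ cong (_++ filter P? [ x ]) (filter-reverse xs) ⟩
    reverse (filter P? xs) ++ filter P? [ x ] ≡⟨ snoc ⟩
    reverse (filter P? (x ∷ xs))              ∎
    where
    open ≡-Reasoning
    snoc : reverse (filter P? xs) ++ filter P? [ x ] ≡ reverse (filter P? (x ∷ xs))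
    snoc with does (P? x)
    ... | true  = sym (unfold-reverse x (filter P? xs))
    ... | false = ++-identityʳ _

  filter-comm : ∀ {q} {Q : Pred A q} (Q? : Decidable Q) (xs : List A) →
                filter P? (filter Q? xs) ≡ filter Q? (filter P? xs)
  filter-comm Q? [] = refl
  filter-comm Q? (x ∷ xs) with does (P? x) in p | does (Q? x) in q
  ... | true  | true  rewrite p | q = cong (x ∷_) (filter-comm Q? xs)
  ... | true  | false rewrite q = filter-comm Q? xs
  ... | false | true  rewrite p = filter-comm Q? xs
  ... | false | false = filter-comm Q? xs

keep : {A : Set} → Bool → A → List A
keep true  x = [ x ]
keep false x = []

filterᵇ-pair : {A : Set} (f : A → Bool) (x y : A) → filterᵇ f (x ∷ y ∷ []) ≡ keep (f x) x ++ keep (f y) y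
filterᵇ-pair f x y with f x | f y in fy
... | true  | true  rewrite fy = refl
... | true  | false rewrite fy = refl
... | false | true  rewrite fy = refl
... | false | false rewrite fy = refl

occurrences : Letter n → Word n → ℕ
occurrences x p = length (filterᵇ (_== x) p)

module _ {x : Letter n} where

  occurrences-↭ : {p q : Word n} → p ↭ q → occurrences x p ≡ occurrences x q
  occurrences-↭ p↭q = ↭-length (filter-↭ (T? ∘ (_== x)) p↭q)

  occurrences-++ : (p q : Word n) → occurrences x (p ++ q) ≡ occurrences x p + occurrences x q
  occurrences-++ p q = trans (cong length (filter-++ (T? ∘ (_== x)) p q)) (length-++ (filterᵇ (_== x) p))

  occurrences-∉ : {p : Word n} → x ∉ p → occurrences x p ≡ 0
  occurrences-∉ {[]}    _   = refl
  occurrences-∉ {z ∷ p} x∉p with z == x in eq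
  ... | true  = ⊥-elim (x∉p (here (sym (==⇒≡ z x eq))))
  ... | false = occurrences-∉ (x∉p ∘ there)

  occurrences-unique : {p : Word n} → Unique p → x ∈ p → occurrences x p ≡ 1
  occurrences-unique {z ∷ p} (z≢p ∷ _) (here refl) with z == z | ==-refl z
  ... | true | refl = cong suc (occurrences-∉ (All¬⇒¬Any z≢p))
  occurrences-unique {z ∷ p} (z≢p ∷ u) (there x∈p) with z == x in eq
  ... | true  = ⊥-elim (All.lookup z≢p x∈p (==⇒≡ z x eq))
  ... | false = occurrences-unique u x∈p

module _ {x y : Letter n} where

  restrict-none : (p : Word n) → occurrences x p ≡ 0 → occurrences y p ≡ 0 → restrict x y p ≡ []
  restrict-none []      _  _  = refl
  restrict-none (z ∷ p) hx hy with z == x | z == y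
  restrict-none (z ∷ p) () hy | true  | _
  restrict-none (z ∷ p) hx () | false | true
  ... | false | false = restrict-none p hx hy

  restrict-onlyˡ : (p : Word n) → occurrences x p ≡ 1 → occurrences y p ≡ 0 → restrict x y p ≡ [ x ]
  restrict-onlyˡ (z ∷ p) hx hy with z == x in eq | z == y
  restrict-onlyˡ (z ∷ p) hx () | _     | true
  ... | true  | false rewrite ==⇒≡ z x eq = cong (x ∷_) (restrict-none p (suc-injective hx) hy)
  ... | false | false = restrict-onlyˡ p hx hy

  restrict-onlyʳ : (p : Word n) → occurrences x p ≡ 0 → occurrences y p ≡ 1 → restrict x y p ≡ [ y ]
  restrict-onlyʳ (z ∷ p) hx hy with z == x | z == y in eq
  restrict-onlyʳ (z ∷ p) () hy | true  | _
  ... | false | true  rewrite ==⇒≡ z y eq = cong (y ∷_) (restrict-none p hx (suc-injective hy))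
  ... | false | false = restrict-onlyʳ p hx hy

  restrict-two : x ≢ y → (p : Word n) → occurrences x p ≡ 1 → occurrences y p ≡ 1 →
                 restrict x y p ≡ x ∷ y ∷ [] ⊎ restrict x y p ≡ y ∷ x ∷ []
  restrict-two x≢y (z ∷ p) hx hy with z == x in eqx | z == y in eqy
  ... | true  | true  = ⊥-elim (x≢y (trans (sym (==⇒≡ z x eqx)) (==⇒≡ z y eqy)))
  ... | true  | false rewrite ==⇒≡ z x eqx = inj₁ (cong (x ∷_) (restrict-onlyʳ p (suc-injective hx) hy))
  ... | false | true  rewrite ==⇒≡ z y eqy = inj₂ (cong (y ∷_) (restrict-onlyˡ p hx (suc-injective hy)))
  ... | false | false = restrict-two x≢y p hx hy

∈-tail : {c z : Letter n} {p : Word n} → c ∈ z ∷ p → (z == c) ≡ false → c ∈ p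
∈-tail {c = c} (here refl) eq with () ← trans (sym (==-refl c)) eq
∈-tail         (there c∈p) _  = c∈p

module _ {c y : Letter n} where

  insertAfter-↭ : {p : Word n} → c ∈ p → insertAfter c y p ↭ y ∷ p
  insertAfter-↭ {z ∷ p} c∈z∷p with z == c in eq
  ... | true  = ↭-swap z y ↭-refl
  ... | false = ↭-trans (↭-prep z (insertAfter-↭ (∈-tail c∈z∷p eq))) (↭-swap z y ↭-refl)

  insertBefore-↭ : {p : Word n} → c ∈ p → insertBefore c y p ↭ y ∷ p
  insertBefore-↭ {z ∷ p} c∈z∷p with z == c in eq
  ... | true  = ↭-refl
  ... | false = ↭-trans (↭-prep z (insertBefore-↭ (∈-tail c∈z∷p eq))) (↭-swap z y ↭-refl)

  module _ {ℓ} {R : Letter n → Letter n → Set ℓ}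
           (below : ∀ {z} → R z c → R z y) (above : ∀ {w} → R c w → R y w) where

    AllPairs-insertAfter : {p : Word n} → c ∈ p → R c y → AllPairs R p → AllPairs R (insertAfter c y p)
    AllPairs-insertAfter {z ∷ p} c∈z∷p Rcy (Rz ∷ Rp) with z == c in eq
    ... | true  rewrite ==⇒≡ z c eq = (Rcy ∷ Rz) ∷ All.map above Rz ∷ Rp
    ... | false = All-resp-↭ (↭-sym (insertAfter-↭ c∈p)) (below (All.lookup Rz c∈p) ∷ Rz)
                ∷ AllPairs-insertAfter c∈p Rcy Rp
      where c∈p = ∈-tail c∈z∷p eq

    AllPairs-insertBefore : {p : Word n} → c ∈ p → R y c → AllPairs R p → AllPairs R (insertBefore c y p)
    AllPairs-insertBefore {z ∷ p} c∈z∷p Ryc (Rz ∷ Rp) with z == c in eq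
    ... | true  rewrite ==⇒≡ z c eq = (Ryc ∷ All.map above Rz) ∷ Rz ∷ Rp
    ... | false = All-resp-↭ (↭-sym (insertBefore-↭ c∈p)) (below (All.lookup Rz c∈p) ∷ Rz)
                ∷ AllPairs-insertBefore c∈p Ryc Rp
      where c∈p = ∈-tail c∈z∷p eq

expandAt : Letter n → Word n → Letter n → Word n
expandAt c X z = if z == c then z ∷ X else [ z ]

filterᵇ-concatMap-expandAt : (f : Letter n → Bool) (c : Letter n) (X cs : Word n) →
                             All (λ z → f z ≡ false) cs →
                             filterᵇ f (concatMap (expandAt c X) cs) ≡ concat (replicate (occurrences c cs) (filterᵇ f X))
filterᵇ-concatMap-expandAt f c X []       []         = refl
filterᵇ-concatMap-expandAt f c X (z ∷ cs) (fz ∷ fcs) = begin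
  filterᵇ f (expandAt c X z ++ concatMap (expandAt c X) cs)
    ≡⟨ filter-++ (T? ∘ f) (expandAt c X z) _ ⟩
  filterᵇ f (expandAt c X z) ++ filterᵇ f (concatMap (expandAt c X) cs)
    ≡⟨ cong (filterᵇ f (expandAt c X z) ++_) (filterᵇ-concatMap-expandAt f c X cs fcs) ⟩
  filterᵇ f (expandAt c X z) ++ concat (replicate (occurrences c cs) (filterᵇ f X))
    ≡⟨ unexpand ⟩
  concat (replicate (occurrences c (z ∷ cs)) (filterᵇ f X)) ∎
  where
  open ≡-Reasoning
  unexpand : filterᵇ f (expandAt c X z) ++ concat (replicate (occurrences c cs) (filterᵇ f X))
           ≡ concat (replicate (occurrences c (z ∷ cs)) (filterᵇ f X))
  unexpand with z == c
  ... | true  rewrite fz = refl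
  ... | false rewrite fz = refl

-- Positions in p₁ and p₂ are measured by keys in ℕ: clique vertex c sits at
-- at c = 3c+1, and an I-vertex inserted just before / just after c gets the key
-- before c = 3c / after c = 3c+2.  I-vertices with equal keys may come in
-- either order, which is why Precedes is non-strict between them.

triple : ℕ → ℕ
triple zero    = zero
triple (suc c) = suc (suc (suc (triple c)))

before at after : ℕ → ℕ
before c = triple c
at     c = suc (triple c)
after  c = suc (suc (triple c))

before≤after : {c : ℕ} → before c ≤ after c
before≤after = ≤-trans (n≤1+n _) (n≤1+n _)

after<before : {c c′ : ℕ} → c < c′ → after c < before c′
after<before {zero}  {suc _} _         = s≤s (s≤s (s≤s z≤n))
after<before {suc _} {suc _} (s≤s c<c′) = s≤s (s≤s (s≤s (after<before c<c′)))

before≤after⇒≤ : {l m : ℕ} → before l ≤ after m → l ≤ m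
before≤after⇒≤ {zero}  _                      = z≤n
before≤after⇒≤ {suc _} {zero}  (s≤s (s≤s ()))
before≤after⇒≤ {suc _} {suc _} (s≤s (s≤s (s≤s h))) = s≤s (before≤after⇒≤ h)

Precedes : (Fin n → ℕ) → Letter n → Letter n → Set
Precedes f (cv c) (cv c′) = c < c′
Precedes f (cv c) (iv b)  = at c < f b
Precedes f (iv a) (cv c)  = f a < at c
Precedes f (iv a) (iv b)  = f a ≤ f b

module JustAfter (f : Fin n → ℕ) {a : Fin n} {c : ℕ} (fa : f a ≡ after c) where

  below : {z : Letter n} → Precedes f z (cv c) → Precedes f z (iv a)
  below {cv c′} c′<c rewrite fa = ≤-trans (<⇒≤ (after<before c′<c)) before≤after
  below {iv b}  h    rewrite fa = ≤-trans (s≤s⁻¹ h) before≤after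

  pivot : Precedes f (cv c) (iv a)
  pivot rewrite fa = ≤-refl

  above : {w : Letter n} → Precedes f (cv c) w → Precedes f (iv a) w
  above {cv c′} c<c′ rewrite fa = <-trans (after<before c<c′) (n<1+n _)
  above {iv b}  h    rewrite fa = h

module JustBefore (f : Fin n → ℕ) {a : Fin n} {c : ℕ} (fa : f a ≡ before c) where

  below : {z : Letter n} → Precedes f z (cv c) → Precedes f z (iv a)
  below {cv c′} c′<c rewrite fa = <-trans (n<1+n (at c′)) (after<before c′<c)
  below {iv b}  h    rewrite fa = s≤s⁻¹ h

  pivot : Precedes f (iv a) (cv c)
  pivot rewrite fa = ≤-refl

  above : {w : Letter n} → Precedes f (cv c) w → Precedes f (iv a) w
  above {cv c′} c<c′ rewrite fa = s≤s (<⇒≤ (≤-<-trans before≤after (after<before c<c′)))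
  above {iv b}  h    rewrite fa = ≤-trans before≤after h

position₁ position₂ : Nb → ℕ
position₁ (nbA m _)  = after m
position₁ (nbB l _)  = before l
position₂ (nbA _ n′) = before n′
position₂ (nbB _ r)  = after r

initWord-sorted : (f : Fin n → ℕ) (k : ℕ) → AllPairs (Precedes f) (initWord k)
initWord-sorted f k = AllPairs.applyUpTo⁺₁ (λ i → cv (suc i)) k (λ i<j _ → s≤s i<j)

cv∈initWord : {c k : ℕ} → 1 ≤ c → c ≤ k → cv {n} c ∈ initWord k
cv∈initWord {c = suc i} _ i<k = ∈-applyUpTo⁺ (λ i → cv (suc i)) i<k

iv∉initWord : (k : ℕ) {a : Fin n} → iv a ∉ initWord k
iv∉initWord k a∈ with ∈-applyUpTo⁻ (λ i → cv (suc i)) a∈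
... | _ , _ , ()

module Construction {n : ℕ} (k : ℕ) (N : Fin n → Nb) where

  record Invariant (M : List (Fin n)) (s : State n) : Set where
    field
      p₁-↭      : State.p₁ s ↭ map iv M ++ initWord k
      p₂-↭      : State.p₂ s ↭ map iv M ++ initWord k
      p₁-sorted : AllPairs (Precedes (position₁ ∘ N)) (State.p₁ s)
      p₂-sorted : AllPairs (Precedes (position₂ ∘ N)) (State.p₂ s)
      1≤d       : 1 ≤ State.d s
      d≤k       : State.d s ≤ k

  initial-invariant : 1 ≤ k → Invariant [] (st (initWord k) (initWord k) 1)
  initial-invariant 1≤k = record
    { p₁-↭ = ↭-refl ; p₂-↭ = ↭-refl
    ; p₁-sorted = initWord-sorted _ k ; p₂-sorted = initWord-sorted _ k
    ; 1≤d = ≤-refl ; d≤k = 1≤k }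

  cv∈ : {M : List (Fin n)} {p : Word n} → p ↭ map iv M ++ initWord k →
        {c : ℕ} → 1 ≤ c → c ≤ k → cv c ∈ p
  cv∈ {M} p↭ 1≤c c≤k = Any-resp-↭ (↭-sym p↭) (∈-++⁺ʳ (map iv M) (cv∈initWord 1≤c c≤k))

  step-invariant : {M : List (Fin n)} (s : State n) (a : Fin n) → ValidNb k (N a) →
                   Invariant M s → Invariant (a ∷ M) (step N s a)
  step-invariant (st p₁ p₂ d) a valid I with N a in eq
  step-invariant (st p₁ p₂ d) a (1≤m , m+1<n′ , n′≤k) I | nbA m n′ = record
    { p₁-↭      = ↭-trans (insertAfter-↭ m∈p₁) (↭-prep (iv a) p₁-↭)
    ; p₂-↭      = ↭-trans (insertBefore-↭ n′∈p₂) (↭-prep (iv a) p₂-↭)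
    ; p₁-sorted = AllPairs-insertAfter A.below A.above m∈p₁ A.pivot p₁-sorted
    ; p₂-sorted = AllPairs-insertBefore B.below B.above n′∈p₂ B.pivot p₂-sorted
    ; 1≤d       = ≤-trans 1≤d (m≤m⊔n d m)
    ; d≤k       = ⊔-lub d≤k m≤k
    }
    where
    open Invariant I
    module A = JustAfter (position₁ ∘ N) {a} {m} (cong position₁ eq)
    module B = JustBefore (position₂ ∘ N) {a} {n′} (cong position₂ eq)
    m≤n′ = ≤-trans (n≤1+n m) (<⇒≤ m+1<n′)
    m≤k = ≤-trans m≤n′ n′≤k
    m∈p₁ = cv∈ p₁-↭ 1≤m m≤k
    n′∈p₂ = cv∈ p₂-↭ (≤-trans 1≤m m≤n′) n′≤k
  step-invariant (st p₁ p₂ d) a ((1≤l , l≤r , r≤k) , _) I | nbB l r = record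
    { p₁-↭      = ↭-trans (insertBefore-↭ l∈p₁) (↭-prep (iv a) p₁-↭)
    ; p₂-↭      = ↭-trans (insertAfter-↭ r∈p₂) (↭-prep (iv a) p₂-↭)
    ; p₁-sorted = AllPairs-insertBefore B.below B.above l∈p₁ B.pivot p₁-sorted
    ; p₂-sorted = AllPairs-insertAfter A.below A.above r∈p₂ A.pivot p₂-sorted
    ; 1≤d       = 1≤d
    ; d≤k       = d≤k
    }
    where
    open Invariant I
    module B = JustBefore (position₁ ∘ N) {a} {l} (cong position₁ eq)
    module A = JustAfter (position₂ ∘ N) {a} {r} (cong position₂ eq)
    l∈p₁ = cv∈ p₁-↭ 1≤l (≤-trans l≤r r≤k)
    r∈p₂ = cv∈ p₂-↭ (≤-trans 1≤l l≤r) r≤k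

  fold-invariant : (∀ a → ValidNb k (N a)) → {M : List (Fin n)} {s : State n} (L : List (Fin n)) →
                   Invariant M s → Invariant (reverseAcc M L) (foldl (step N) s L)
  fold-invariant valid []      I = I
  fold-invariant valid (a ∷ L) I = fold-invariant valid L (step-invariant _ a (valid a) I)

  final-invariant : (∀ a → ValidNb k (N a)) → 1 ≤ k → Invariant (reverse (allFin n)) (final k N)
  final-invariant valid 1≤k = fold-invariant valid (allFin n) (initial-invariant 1≤k)

  occurrences-once : {p : Word n} → p ↭ map iv (reverse (allFin n)) ++ initWord k →
                     (x : Fin n) → occurrences (iv x) p ≡ 1
  occurrences-once {p} p↭ x = begin
    occurrences (iv x) p
      ≡⟨ occurrences-↭ (↭-trans p↭ (++⁺ʳ (initWord k) (↭.map⁺ iv (↭-reverse (allFin n))))) ⟩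
    occurrences (iv x) (map iv (allFin n) ++ initWord k)
      ≡⟨ occurrences-++ (map iv (allFin n)) (initWord k) ⟩
    occurrences (iv x) (map iv (allFin n)) + occurrences (iv x) (initWord k)
      ≡⟨ cong₂ _+_ (occurrences-unique (Unique.map⁺ iv-injective (allFin⁺ n)) (∈-map⁺ iv (∈-allFin x)))
                   (occurrences-∉ (iv∉initWord k)) ⟩
    1 ∎
    where open ≡-Reasoning

Alternating : Letter n → Letter n → Word n → Set
Alternating x y u = u ≡ altWord x y (length u) ⊎ u ≡ altWord y x (length u)

wordShape : (Fin n → Nb) → Word n → Word n → Word n
wordShape N r₁ r₂ = r₁ ++ reverse (filterᵇ (inB N) r₁) ++ r₂ ++ reverse (filterᵇ (inA N) r₁)

alternating-wordShape⇒crossing : (N : Fin n → Nb) {a b : Fin n} → a ≢ b → (r₂ : Word n) →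
                                 r₂ ≡ iv a ∷ iv b ∷ [] ⊎ r₂ ≡ iv b ∷ iv a ∷ [] →
                                 Alternating (iv a) (iv b) (wordShape N (iv a ∷ iv b ∷ []) r₂) →
                                 isA (N a) ≡ false × isA (N b) ≡ true × r₂ ≡ iv b ∷ iv a ∷ []
alternating-wordShape⇒crossing N {a} {b} a≢b r₂ r₂≡ alt
  -- with-abstraction alone does not reach isA (N a) inside filterᵇ; filterᵇ-pair exposes it
  rewrite filterᵇ-pair (inB N) (iv a) (iv b) | filterᵇ-pair (inA N) (iv a) (iv b)
  with isA (N a) | isA (N b) | r₂≡ | alt
... | false | true  | inj₂ refl | _         = refl , refl , refl
-- in every other case the word has two equal adjacent letters
... | false | true  | inj₁ refl | inj₁ refl = ⊥-elim (a≢b refl)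
... | false | true  | inj₁ refl | inj₂ refl = ⊥-elim (a≢b refl)
... | true  | true  | inj₁ refl | inj₁ refl = ⊥-elim (a≢b refl)
... | true  | true  | inj₁ refl | inj₂ refl = ⊥-elim (a≢b refl)
... | true  | true  | inj₂ refl | inj₁ refl = ⊥-elim (a≢b refl)
... | true  | true  | inj₂ refl | inj₂ refl = ⊥-elim (a≢b refl)
... | false | false | inj₁ refl | inj₁ refl = ⊥-elim (a≢b refl)
... | false | false | inj₁ refl | inj₂ refl = ⊥-elim (a≢b refl)
... | false | false | inj₂ refl | inj₁ refl = ⊥-elim (a≢b refl)
... | false | false | inj₂ refl | inj₂ refl = ⊥-elim (a≢b refl)
... | true  | false | inj₁ refl | inj₁ refl = ⊥-elim (a≢b refl)
... | true  | false | inj₁ refl | inj₂ refl = ⊥-elim (a≢b refl)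
... | true  | false | inj₂ refl | inj₁ refl = ⊥-elim (a≢b refl)
... | true  | false | inj₂ refl | inj₂ refl = ⊥-elim (a≢b refl)

restrict-reverse-filter : {x y : Letter n} (f : Letter n → Bool) (p : Word n) →
                          restrict x y (reverse (filterᵇ f p)) ≡ reverse (filterᵇ f (restrict x y p))
restrict-reverse-filter {x = x} {y} f p =
  trans (filter-reverse (T? ∘ λ z → (z == x) ∨ (z == y)) (filterᵇ f p))
        (cong reverse (filter-comm _ (T? ∘ f) p))

restrict-expandAt-initWord : {x y : Fin n} {d k : ℕ} → 1 ≤ d → d ≤ k → (X : Word n) →
                             restrict (iv x) (iv y) (concatMap (expandAt (cv d) X) (initWord k)) ≡ restrict (iv x) (iv y) X
restrict-expandAt-initWord {x = x} {y} {d} {k} 1≤d d≤k X = begin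
  restrict (iv x) (iv y) (concatMap (expandAt (cv d) X) (initWord k))
    ≡⟨ filterᵇ-concatMap-expandAt _ (cv d) X (initWord k) (applyUpTo⁺₂ _ k (λ _ → refl)) ⟩
  concat (replicate (occurrences (cv d) (initWord k)) (restrict (iv x) (iv y) X))
    ≡⟨ cong (λ m → concat (replicate m (restrict (iv x) (iv y) X))) (occurrences-unique initWord-unique (cv∈initWord 1≤d d≤k)) ⟩
  restrict (iv x) (iv y) X ++ []
    ≡⟨ ++-identityʳ _ ⟩
  restrict (iv x) (iv y) X ∎
  where
  open ≡-Reasoning
  initWord-unique : Unique (initWord {n} k)
  initWord-unique = Unique.applyUpTo⁺₁ _ k λ { i<i _ refl → <-irrefl refl i<i }

restrict-wordW : (k : ℕ) (N : Fin n → Nb) {x y : Fin n} →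
                 let open State (final k N) in 1 ≤ d → d ≤ k →
                 restrict (iv x) (iv y) (wordW k N) ≡ wordShape N (restrict (iv x) (iv y) p₁) (restrict (iv x) (iv y) p₂)
restrict-wordW k N {x} {y} 1≤d d≤k = begin
  ρ (p₁ ++ R ++ p₂ ++ p₃)        ≡⟨ filter-++ P? p₁ _ ⟩
  ρ p₁ ++ ρ (R ++ p₂ ++ p₃)      ≡⟨ cong (ρ p₁ ++_) (filter-++ P? R _) ⟩
  ρ p₁ ++ ρ R ++ ρ (p₂ ++ p₃)    ≡⟨ cong (λ u → ρ p₁ ++ ρ R ++ u) (filter-++ P? p₂ p₃) ⟩
  ρ p₁ ++ ρ R ++ ρ p₂ ++ ρ p₃    ≡⟨ cong₂ (λ u v → ρ p₁ ++ u ++ ρ p₂ ++ v)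
                                          (restrict-reverse-filter (inB N) p₁)
                                          (trans (restrict-expandAt-initWord 1≤d d≤k _) (restrict-reverse-filter (inA N) p₁)) ⟩
  wordShape N (ρ p₁) (ρ p₂)      ∎
  where
  open ≡-Reasoning
  open State (final k N)
  ρ = restrict (iv x) (iv y)
  P? = T? ∘ λ z → (z == iv x) ∨ (z == iv y)
  R = reverse (filterᵇ (inB N) p₁)
  p₃ = concatMap (expandAt (cv d) (reverse (filterᵇ (inA N) p₁))) (initWord k)

precedes-in-restriction : ∀ {ℓ} {R : Letter n → Letter n → Set ℓ} {x y u v : Letter n} {p : Word n} →
                          AllPairs R p → restrict x y p ≡ u ∷ v ∷ [] → R u v
precedes-in-restriction {x = x} {y} sorted eq with subst (AllPairs _) eq (AllPairs.filter⁺ (T? ∘ λ z → (z == x) ∨ (z == y)) sorted)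
... | (Ruv ∷ []) ∷ _ = Ruv

crossing-violates-compat : {na nb : Nb} → isA na ≡ false → isA nb ≡ true →
                           position₁ na ≤ position₁ nb → position₂ nb ≤ position₂ na → ¬ Compat nb na
crossing-violates-compat {nbB l r} {nbA m n′} _ _ l≲m _    (inj₁ m<l)  = <⇒≱ m<l (before≤after⇒≤ l≲m)
crossing-violates-compat {nbB l r} {nbA m n′} _ _ _   n′≲r (inj₂ r<n′) = <⇒≱ r<n′ (before≤after⇒≤ n′≲r)

ValidNb⇒1≤k : {k : ℕ} (nb : Nb) → ValidNb k nb → 1 ≤ k
ValidNb⇒1≤k (nbA m n′) (1≤m , m+1<n′ , n′≤k)  = ≤-trans 1≤m (≤-trans (n≤1+n m) (≤-trans (<⇒≤ m+1<n′) n′≤k))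
ValidNb⇒1≤k (nbB l r)  ((1≤l , l≤r , r≤k) , _) = ≤-trans 1≤l (≤-trans l≤r r≤k)

lemma3 : (k n : ℕ) (N : Fin n → Nb) →
         (∀ a → ValidNb k (N a)) →
         (∀ a b → Compat (N a) (N b)) →
         (a b : Fin n) → a ≢ b →
         ¬ Alternate (iv a) (iv b) (wordW k N)
lemma3 k n N valid compat a b a≢b alt =
  [ (λ r₁≡ab → crossing a b a≢b r₁≡ab r₂-orders alt′)
  , (λ r₁≡ba → crossing b a (a≢b ∘ sym) r₁≡ba (Sum.swap r₂-orders) (Sum.swap alt′))
  ]′ (restrict-two (a≢b ∘ iv-injective) p₁ (occurrences-once p₁-↭ a) (occurrences-once p₁-↭ b))
  where
  open Construction k N
  open Invariant (final-invariant valid (ValidNb⇒1≤k (N a) (valid a)))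
  open State (final k N)
  ρ = restrict (iv a) (iv b)
  r₂-orders = restrict-two (a≢b ∘ iv-injective) p₂ (occurrences-once p₂-↭ a) (occurrences-once p₂-↭ b)
  alt′ : Alternating (iv a) (iv b) (wordShape N (ρ p₁) (ρ p₂))
  alt′ = subst (Alternating (iv a) (iv b)) (restrict-wordW k N 1≤d d≤k) alt
  crossing : (x y : Fin n) → x ≢ y → ρ p₁ ≡ iv x ∷ iv y ∷ [] →
             ρ p₂ ≡ iv x ∷ iv y ∷ [] ⊎ ρ p₂ ≡ iv y ∷ iv x ∷ [] →
             Alternating (iv x) (iv y) (wordShape N (ρ p₁) (ρ p₂)) → ⊥
  crossing x y x≢y r₁≡xy r₂-cases alt-xy
    with alternating-wordShape⇒crossing N x≢y (ρ p₂) r₂-cases (subst (λ r → Alternating (iv x) (iv y) (wordShape N r (ρ p₂))) r₁≡xy alt-xy)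
  ... | x∉A , y∈A , r₂≡yx = crossing-violates-compat x∉A y∈A
                              (precedes-in-restriction p₁-sorted r₁≡xy) (precedes-in-restriction p₂-sorted r₂≡yx) (compat y x)
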